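{- Let $\pi=(d_1,\dots,d_n)$ be the degree sequence of a tree with $d_1\ge d_2\ge\cdots\ge d_k\ge 2$ and $d_{k+1}=\cdots=d_n=1$, where $k\ge 3$. If $C(z_1,\dots,z_k)$ is a maximum optimal caterpillar in $\mathcal{C}_\pi$ (i.e. it maximizes $\varphi$ over $\mathcal{C}_\pi$), then there exists an integer $t$ with $1\le t\le k-1$ such that $$z_1\le z_2\le\cdots\le z_{t-1}<z_t\quad\text{and}\quad z_t\ge z_{t+1}\ge\cdots\ge z_k.$$
   Context: A subtree of a tree is a nonempty connected subgraph; $\varphi(T)$ is the number of nonempty subtrees of $T$. A caterpillar is a tree containing a path such that every vertex not on the path is adjacent to a vertex on the path; $\mathcal{C}_\pi$ is the set of caterpillars with degree sequence $\pi$. For a permutation $(z_1,\dots,z_k)$ of $(d_1-2,\dots,d_k-2)$, $C(z_1,\dots,z_k)$ is the caterpillar obtained from a path $v_0v_1\cdots v_kv_{k+1}$ by attaching $z_j$ new pendant vertices to $v_j$ for $j=1,\dots,k$; every member of $\mathcal{C}_\pi$ is of this form. -}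

module Defs where

open import Data.Nat using (ℕ; zero; suc; _+_; _*_; _∸_; _≤_; _<_)
open import Data.Bool using (Bool; true; false)
open import Data.List using (List; []; _∷_; map; _++_; upTo; length; take)
open import Data.Nat.ListAction using (sum)
open import Data.List.Membership.Propositional using (_∈_)
open import Data.List.Relation.Unary.Unique.Propositional using (Unique)
open import Data.Vec using (Vec; toList)
open import Data.Product using (_×_; _,_; ∃)
open import Data.Sum using (_⊎_)
open import Function.Bundles using (_⇔_)
open import Relation.Binary.PropositionalEquality using (_≡_)

-- Graphs given by a vertex count N (vertices 0 … N-1) and an edge list.

Edge : Set
Edge = ℕ × ℕ

Adj : List Edge → ℕ → ℕ → Set
Adj E u v = ((u , v) ∈ E) ⊎ ((v , u) ∈ E)

-- 0-based lookup in a list of booleans (false outside the range)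
atB : List Bool → ℕ → Bool
atB []       _       = false
atB (b ∷ bs) zero    = b
atB (b ∷ bs) (suc i) = atB bs i

-- vertex sets of the graph are subsets of {0,…,N-1}, as Vec Bool N
_∈ₛ_ : {N : ℕ} → ℕ → Vec Bool N → Set
u ∈ₛ S = (atB (toList S) u ≡ true)

data Walk (E : List Edge) {N : ℕ} (S : Vec Bool N) : ℕ → ℕ → Set where
  here : ∀ {u} → u ∈ₛ S → Walk E S u u
  step : ∀ {u w v} → u ∈ₛ S → Adj E u w → Walk E S w v → Walk E S u v

-- S induces a nonempty connected subgraph.  In a tree, subtrees
-- (nonempty connected subgraphs) correspond bijectively to such vertex sets.
IsSubtree : (N : ℕ) → List Edge → Vec Bool N → Set
IsSubtree N E S = ∃ (λ u → u ∈ₛ S) × (∀ u v → u ∈ₛ S → v ∈ₛ S → Walk E S u v)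

SubtreeCount : (N : ℕ) → List Edge → ℕ → Set
SubtreeCount N E m =
  ∃ λ (L : List (Vec Bool N)) →
    Unique L × (∀ S → (S ∈ L) ⇔ IsSubtree N E S) × (length L ≡ m)

-- The caterpillar C(z₁,…,z_k): spine v₀ … v_{k+1} numbered 0 … k+1,
-- pendant vertices numbered from k+2 onwards, z_j of them attached to v_j.

catN : List ℕ → ℕ
catN z = length z + 2 + sum z

spineEdges : ℕ → List Edge
spineEdges k = map (λ i → (i , suc i)) (upTo (suc k))

leafEdges : ℕ → ℕ → List ℕ → List Edge
leafEdges j nxt []       = []
leafEdges j nxt (c ∷ cs) =
  map (λ l → (j , nxt + l)) (upTo c) ++ leafEdges (suc j) (nxt + c) cs

catEdges : List ℕ → List Edge
catEdges z = spineEdges (length z) ++ leafEdges 1 (length z + 2) z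

φCat≡ : List ℕ → ℕ → Set
φCat≡ z m = SubtreeCount (catN z) (catEdges z) m

-- 1-based indexing into a list of naturals (0 outside the range)

at : List ℕ → ℕ → ℕ
at []       _             = 0
at (x ∷ xs) zero          = 0
at (x ∷ xs) (suc zero)    = x
at (x ∷ xs) (suc (suc i)) = at xs (suc i)

IsTreeDegSeq : List ℕ → Set
IsTreeDegSeq d =
  (2 ≤ length d) × (∀ i → 1 ≤ i → i ≤ length d → 1 ≤ at d i)
  × (sum d ≡ 2 * (length d ∸ 1))

ShapeOK : List ℕ → ℕ → Set
ShapeOK d k =
  (3 ≤ k) × (k ≤ length d)
  × (∀ i → 1 ≤ i → i < k → at d (suc i) ≤ at d i)
  × (2 ≤ at d k)
  × (∀ i → k < i → i ≤ length d → at d i ≡ 1)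

excess : List ℕ → ℕ → List ℕ
excess d k = map (λ x → x ∸ 2) (take k d)

{-# OPTIONS --safe #-}
-- Let A = 2 ^ z_j and B = 2 ^ z_{j+1}.  Transposing z_j and z_{j+1} changes φ(C(z)) by
-- (B − A)(L_j − R_j), where L_j − 1 counts the subtrees containing v_{j−1} of the part of C(z)
-- left of v_j, and R_j − 1 those containing v_{j+2} of the part right of v_{j+1}.  L_j grows and
-- R_j shrinks with j, and R_{k−1} = 2 < L_{k−1} because k ≥ 3.  Maximality thus forces
-- z_j ≤ z_{j+1} while L_j < R_j and z_j ≥ z_{j+1} once R_j < L_j, and t is the left end of the top
-- plateau.  To compute φ(C(z)) at all, subtrees are counted as the vertex sets accepted by a
-- three-state automaton reading the spine from v₀ to v_{k+1}.
module Submission where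

open import Data.Bool using (Bool; true; false; _∧_; if_then_else_)
open import Data.Bool.Properties using (¬-not)
open import Data.Empty using (⊥)
open import Data.List using (List; []; _∷_; _++_; [_]; take; drop; length; map; upTo)
open import Data.List.Properties
  using (++-assoc; take++drop≡id; drop-all; length-++; length-map; length-drop; length-take)
open import Data.List.Membership.Propositional using (_∈_)
open import Data.List.Membership.Propositional.Properties
  using (∈-map⁺; ∈-map⁻; ∈-++⁺ˡ; ∈-++⁺ʳ; ∈-++⁻; ∈-upTo⁺; ∈-upTo⁻)
open import Data.List.Relation.Binary.Permutation.Propositional
  using (_↭_; ↭-refl; ↭-trans) renaming (swap to ↭-swap)
open import Data.List.Relation.Binary.Permutation.Propositional.Properties
  using (↭-length) renaming (++⁺ˡ to ↭-++⁺ˡ)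
open import Data.List.Relation.Unary.All using ([])
open import Data.List.Relation.Unary.AllPairs using ([]; _∷_)
open import Data.List.Relation.Unary.Any using (here)
open import Data.List.Relation.Unary.Unique.Propositional using (Unique)
import Data.List.Relation.Unary.Unique.Propositional.Properties as Unique
open import Data.Nat
open import Data.Nat.ListAction using (sum)
open import Data.Nat.ListAction.Properties using (sum-++)
open import Data.Nat.Properties
open import Data.Nat.Tactic.RingSolver using (solve-∀)
open import Data.Product using (∃; _×_; _,_; proj₁; proj₂)
import Data.Product as Product
open import Data.Sum using (_⊎_; inj₁; inj₂)
import Data.Vec as Vec
open Vec using (Vec; toList)
open import Data.Vec.Properties using (∷-injectiveʳ; length-toList)
open import Function using (_∘_)
open import Function.Bundles using (_⇔_; mk⇔; Equivalence)
open import Relation.Binary.PropositionalEquality hiding ([_])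
open import Relation.Nullary using (¬_; yes; no; contradiction)
open import Relation.Nullary.Decidable using (_→-dec_)
open import Relation.Unary using (Pred; Decidable)

open import Defs

-- Unimodality from local exchange conditions

NondecreasingUpTo : (ℕ → ℕ) → ℕ → Set
NondecreasingUpTo f q = ∀ i → 1 ≤ i → suc i ≤ q → f i ≤ f (suc i)

NonincreasingFrom : (ℕ → ℕ) → ℕ → ℕ → Set
NonincreasingFrom f q k = ∀ i → q ≤ i → suc i ≤ k → f (suc i) ≤ f i

StrictPeakAt : (ℕ → ℕ) → ℕ → ℕ → Set
StrictPeakAt f k t = (1 ≤ t) × (t ≤ k ∸ 1) × NondecreasingUpTo f (t ∸ 1)
  × (2 ≤ t → f (t ∸ 1) < f t) × NonincreasingFrom f t k

nondecreasingUpTo-pred : ∀ {f q} → NondecreasingUpTo f (suc q) → NondecreasingUpTo f q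
nondecreasingUpTo-pred up i 1≤i si≤q = up i 1≤i (m≤n⇒m≤1+n si≤q)

nondecreasingUpTo-suc : ∀ {f q} → f q ≤ f (suc q) → NondecreasingUpTo f q → NondecreasingUpTo f (suc q)
nondecreasingUpTo-suc fq≤ up i 1≤i (s≤s i≤q) with m≤n⇒m<n∨m≡n i≤q
... | inj₁ i<q = up i 1≤i i<q
... | inj₂ refl = fq≤

nonincreasingFrom-pred : ∀ {f q k} → f (suc q) ≤ f q → NonincreasingFrom f (suc q) k → NonincreasingFrom f q k
nonincreasingFrom-pred fsq≤ down i q≤i si≤k with m≤n⇒m<n∨m≡n q≤i
... | inj₁ q<i = down i q<i si≤k
... | inj₂ refl = fsq≤

unimodal⇒strictPeak : ∀ {f k} s → suc s ≤ k ∸ 1 →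
  NondecreasingUpTo f (suc s) → NonincreasingFrom f (suc s) k → ∃ (StrictPeakAt f k)
unimodal⇒strictPeak zero s<k up down =
  1 , ≤-refl , s<k , (λ _ _ ()) , (λ 2≤1 → contradiction 2≤1 (<-irrefl refl)) , down
unimodal⇒strictPeak {f} (suc s) s<k up down with f (suc s) <? f (suc (suc s))
... | yes ascent = suc (suc s) , s≤s z≤n , s<k , nondecreasingUpTo-pred up , (λ _ → ascent) , down
... | no ¬ascent = unimodal⇒strictPeak s (≤-trans (n≤1+n _) s<k)
  (nondecreasingUpTo-pred up) (nonincreasingFrom-pred (≮⇒≥ ¬ascent) down)

firstFailure : ∀ {ℓ} {P : Pred ℕ ℓ} → Decidable P → ∀ m →
  (∀ i → i < m → P i) ⊎ ∃ λ p → p < m × ¬ P p × (∀ i → i < p → P i)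
firstFailure P? zero = inj₁ λ _ ()
firstFailure {P = P} P? (suc m) with firstFailure P? m
... | inj₂ (p , p<m , ¬Pp , before) = inj₂ (p , m<n⇒m<1+n p<m , ¬Pp , before)
... | inj₁ before with P? m
...   | no ¬Pm = inj₂ (m , ≤-refl , ¬Pm , before)
...   | yes Pm = inj₁ below-suc
  where
  below-suc : ∀ i → i < suc m → P i
  below-suc i (s≤s i≤m) with m≤n⇒m<n∨m≡n i≤m
  ... | inj₁ i<m = before i i<m
  ... | inj₂ refl = Pm

module _ {f L R : ℕ → ℕ} {M : ℕ}
  (L-increasing : ∀ j → 1 ≤ j → suc j ≤ M → L j < L (suc j))
  (R-decreasing : ∀ j → 1 ≤ j → suc j ≤ M → R (suc j) < R j)
  (R<L-at-end : R M < L M)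
  (descent-if-R<L : ∀ j → 1 ≤ j → j ≤ M → R j < L j → f (suc j) ≤ f j)
  (ascent-if-L<R : ∀ j → 1 ≤ j → j ≤ M → L j < R j → f j ≤ f (suc j))
  where

  R<L-after : ∀ {p} → 1 ≤ p → R p ≤ L p → ∀ i → p < i → i ≤ M → R i < L i
  R<L-after {p} 1≤p R≤L (suc i) (s≤s p≤i) si≤M = begin-strict
    R (suc i) <⟨ R-decreasing i 1≤i si≤M ⟩
    R i       ≤⟨ R≤L-at-i ⟩
    L i       <⟨ L-increasing i 1≤i si≤M ⟩
    L (suc i) ∎
    where
    open ≤-Reasoning
    1≤i : 1 ≤ i
    1≤i = ≤-trans 1≤p p≤i
    R≤L-at-i : R i ≤ L i
    R≤L-at-i with m≤n⇒m<n∨m≡n p≤i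
    ... | inj₁ p<i = <⇒≤ (R<L-after 1≤p R≤L i p<i (<⇒≤ si≤M))
    ... | inj₂ refl = R≤L

  module _ {s} (s<M : suc s ≤ M) (R≤L : R (suc s) ≤ L (suc s))
    (L<R-before : ∀ i → i < suc s → 1 ≤ i → L i < R i) where

    ascentsUpTo : NondecreasingUpTo f (suc s)
    ascentsUpTo i 1≤i i<p = ascent-if-L<R i 1≤i (≤-trans (<⇒≤ i<p) s<M) (L<R-before i i<p 1≤i)

    descentsFrom : NonincreasingFrom f (2 + s) (suc M)
    descentsFrom i p<i (s≤s i≤M) =
      descent-if-R<L i (≤-trans (s≤s z≤n) (<⇒≤ p<i)) i≤M (R<L-after (s≤s z≤n) R≤L i p<i i≤M)

    peakAtFirstCrossing : ∃ (StrictPeakAt f (suc M))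
    peakAtFirstCrossing with f (2 + s) ≤? f (suc s)
    ... | yes descent = unimodal⇒strictPeak s s<M ascentsUpTo (nonincreasingFrom-pred descent descentsFrom)
    ... | no ¬descent = unimodal⇒strictPeak (suc s) p<M
      (nondecreasingUpTo-suc (<⇒≤ (≰⇒> ¬descent)) ascentsUpTo) descentsFrom
      where
      p<M : suc s < M
      p<M = ≤∧≢⇒< s<M λ { refl → ¬descent (descent-if-R<L M (s≤s z≤n) ≤-refl R<L-at-end) }

  weightCrossing⇒strictPeak : 1 ≤ M → ∃ (StrictPeakAt f (suc M))
  weightCrossing⇒strictPeak 1≤M with firstFailure (λ j → (1 ≤? j) →-dec (L j <? R j)) (suc M)
  ... | inj₁ L<R-everywhere = contradiction R<L-at-end (<-asym (L<R-everywhere M ≤-refl 1≤M))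
  ... | inj₂ (zero , _ , ¬vacuous , _) = contradiction (λ ()) ¬vacuous
  ... | inj₂ (suc s , s<sM , ¬L<R , L<R-before) =
    peakAtFirstCrossing (s≤s⁻¹ s<sM) (≮⇒≥ λ L<R → ¬L<R λ _ → L<R) L<R-before

-- Subtree counts of caterpillars

-- A list cs stands for the caterpillar whose spine u₁ … uₘ carries cᵢ pendant leaves at uᵢ;
-- subtreesFromFirst and subtreesToLast count its subtrees containing u₁, resp. uₘ.
subtreesFromFirst : List ℕ → ℕ
subtreesFromFirst []       = 0
subtreesFromFirst (c ∷ cs) = 2 ^ c * suc (subtreesFromFirst cs)

subtreesToLast : List ℕ → ℕ
subtreesToLast []       = 0
subtreesToLast (c ∷ cs) = 2 ^ sum (c ∷ cs) + subtreesToLast cs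

subtrees : List ℕ → ℕ
subtrees []       = 0
subtrees (c ∷ cs) = subtreesFromFirst (c ∷ cs) + subtrees cs + c

subtreesFromFirst-++ : ∀ xs ys →
  subtreesFromFirst (xs ++ ys) ≡ subtreesFromFirst xs + 2 ^ sum xs * subtreesFromFirst ys
subtreesFromFirst-++ []       ys = sym (+-identityʳ _)
subtreesFromFirst-++ (x ∷ xs) ys = begin
  2 ^ x * suc (subtreesFromFirst (xs ++ ys))
    ≡⟨ cong (λ n → 2 ^ x * suc n) (subtreesFromFirst-++ xs ys) ⟩
  2 ^ x * suc (subtreesFromFirst xs + 2 ^ sum xs * subtreesFromFirst ys)
    ≡⟨ distribute (2 ^ x) (subtreesFromFirst xs) (2 ^ sum xs) (subtreesFromFirst ys) ⟩
  2 ^ x * suc (subtreesFromFirst xs) + 2 ^ x * 2 ^ sum xs * subtreesFromFirst ys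
    ≡⟨ cong (λ n → 2 ^ x * suc (subtreesFromFirst xs) + n * subtreesFromFirst ys) (^-distribˡ-+-* 2 x (sum xs)) ⟨
  2 ^ x * suc (subtreesFromFirst xs) + 2 ^ (x + sum xs) * subtreesFromFirst ys ∎
  where
  open ≡-Reasoning
  distribute : ∀ X r Y s → X * suc (r + Y * s) ≡ X * suc r + X * Y * s
  distribute = solve-∀

subtrees-++ : ∀ xs ys →
  subtrees (xs ++ ys) ≡ subtrees xs + subtreesToLast xs * subtreesFromFirst ys + subtrees ys
subtrees-++ []       ys = refl
subtrees-++ (x ∷ xs) ys
  rewrite subtreesFromFirst-++ (x ∷ xs) ys | subtrees-++ xs ys =
  regroup (subtreesFromFirst (x ∷ xs)) (2 ^ sum (x ∷ xs)) (subtreesFromFirst ys)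
    (subtrees xs) (subtreesToLast xs) (subtrees ys) x
  where
  regroup : ∀ f P g t l u x → f + P * g + (t + l * g + u) + x ≡ f + t + x + (P + l) * g + u
  regroup = solve-∀

subtreesToLast-snoc : ∀ xs y → subtreesToLast (xs ++ [ y ]) ≡ 2 ^ y * suc (subtreesToLast xs)
subtreesToLast-snoc []       y =
  trans (+-identityʳ _) (trans (cong (2 ^_) (+-identityʳ y)) (sym (*-identityʳ _)))
subtreesToLast-snoc (x ∷ xs) y = begin
  2 ^ sum (x ∷ xs ++ [ y ]) + subtreesToLast (xs ++ [ y ])
    ≡⟨ cong₂ _+_ (cong (2 ^_) (sum-++ (x ∷ xs) [ y ])) (subtreesToLast-snoc xs y) ⟩
  2 ^ (sum (x ∷ xs) + (y + 0)) + 2 ^ y * suc (subtreesToLast xs)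
    ≡⟨ cong (λ n → n + 2 ^ y * suc (subtreesToLast xs)) (^-distribˡ-+-* 2 (sum (x ∷ xs)) (y + 0)) ⟩
  2 ^ sum (x ∷ xs) * 2 ^ (y + 0) + 2 ^ y * suc (subtreesToLast xs)
    ≡⟨ cong (λ n → 2 ^ sum (x ∷ xs) * 2 ^ n + 2 ^ y * suc (subtreesToLast xs)) (+-identityʳ y) ⟩
  2 ^ sum (x ∷ xs) * 2 ^ y + 2 ^ y * suc (subtreesToLast xs)
    ≡⟨ factor (2 ^ sum (x ∷ xs)) (2 ^ y) (subtreesToLast xs) ⟩
  2 ^ y * suc (2 ^ sum (x ∷ xs) + subtreesToLast xs) ∎
  where
  open ≡-Reasoning
  factor : ∀ P Y l → P * Y + Y * suc l ≡ Y * suc (P + l)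
  factor = solve-∀

-- The terms of subtrees (xs ++ a ∷ b ∷ ys) that are not symmetric in a and b are
-- exactly 2 ^ a * suc (subtreesToLast xs) + 2 ^ b * suc (subtreesFromFirst ys).
subtrees-exchange : ∀ xs a b ys →
  let L = suc (subtreesToLast xs) ; R = suc (subtreesFromFirst ys) in
  subtrees (xs ++ a ∷ b ∷ ys) + (2 ^ a * R + 2 ^ b * L)
    ≡ subtrees (xs ++ b ∷ a ∷ ys) + (2 ^ a * L + 2 ^ b * R)
subtrees-exchange xs a b ys
  rewrite subtrees-++ xs (a ∷ b ∷ ys) | subtrees-++ xs (b ∷ a ∷ ys) =
  symmetric (subtrees xs) (subtreesToLast xs) (2 ^ a) (2 ^ b) (subtreesFromFirst ys) (subtrees ys) a b
  where
  symmetric : ∀ t l A B r u a b →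
    t + l * (A * suc (B * suc r)) + (A * suc (B * suc r) + (B * suc r + u + b) + a) + (A * suc r + B * suc l)
      ≡ t + l * (B * suc (A * suc r)) + (B * suc (A * suc r) + (A * suc r + u + a) + b) + (A * suc l + B * suc r)
  symmetric = solve-∀

rearrangement : ∀ {a b c d} → a < b → c < d → a * d + b * c < a * c + b * d
rearrangement {a} {b} {c} {d} a<b c<d with m≤n⇒∃[o]m+o≡n a<b | m≤n⇒∃[o]m+o≡n c<d
... | x , refl | y , refl = subst (a * suc (c + y) + suc (a + x) * c <_) (gain a x c y) (m<m+n _ (s≤s z≤n))
  where
  gain : ∀ a x c y → a * suc (c + y) + suc (a + x) * c + suc x * suc y ≡ a * c + suc (a + x) * suc (c + y)
  gain = solve-∀

subtrees-swap-< : ∀ xs a b ys →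
  let L = suc (subtreesToLast xs) ; R = suc (subtreesFromFirst ys) in
  2 ^ a * L + 2 ^ b * R < 2 ^ a * R + 2 ^ b * L →
  subtrees (xs ++ a ∷ b ∷ ys) < subtrees (xs ++ b ∷ a ∷ ys)
subtrees-swap-< xs a b ys gain = +-cancelʳ-< _ _ _ (begin-strict
  subtrees (xs ++ a ∷ b ∷ ys) + (2 ^ a * R + 2 ^ b * L) ≡⟨ subtrees-exchange xs a b ys ⟩
  subtrees (xs ++ b ∷ a ∷ ys) + (2 ^ a * L + 2 ^ b * R) <⟨ +-monoʳ-< (subtrees (xs ++ b ∷ a ∷ ys)) gain ⟩
  subtrees (xs ++ b ∷ a ∷ ys) + (2 ^ a * R + 2 ^ b * L) ∎)
  where
  open ≤-Reasoning
  L R : ℕ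
  L = suc (subtreesToLast xs)
  R = suc (subtreesFromFirst ys)

-- The spine of C(z) is v₀ v₁ … v_{k+1}, and v₀, v_{k+1} carry no leaves.
withEnds : List ℕ → List ℕ
withEnds z = 0 ∷ z ++ [ 0 ]

φ : List ℕ → ℕ
φ z = subtrees (withEnds z)

leftWeight rightWeight : List ℕ → ℕ → ℕ
leftWeight  z j = suc (subtreesToLast (0 ∷ take (j ∸ 1) z))
rightWeight z j = suc (subtreesFromFirst (drop (suc j) z ++ [ 0 ]))

swapAt : List ℕ → ℕ → List ℕ
swapAt z j = take (j ∸ 1) z ++ at z (suc j) ∷ at z j ∷ drop (suc j) z

drop-at : ∀ z j → suc j ≤ length z → drop j z ≡ at z (suc j) ∷ drop (suc j) z
drop-at (x ∷ z) zero    _         = refl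
drop-at (x ∷ z) (suc j) (s≤s j<n) = drop-at z j j<n

take-at : ∀ z j → 1 ≤ j → j ≤ length z → take j z ≡ take (j ∸ 1) z ++ [ at z j ]
take-at (x ∷ z) (suc zero)    _ _         = refl
take-at (x ∷ z) (suc (suc j)) _ (s≤s j≤n) = cong (x ∷_) (take-at z (suc j) (s≤s z≤n) j≤n)

splitAt : ∀ z j → 1 ≤ j → suc j ≤ length z → z ≡ take (j ∸ 1) z ++ at z j ∷ at z (suc j) ∷ drop (suc j) z
splitAt z (suc j) _ j<n = begin
  z
    ≡⟨ take++drop≡id j z ⟨
  take j z ++ drop j z
    ≡⟨ cong (take j z ++_) (drop-at z j (<⇒≤ j<n)) ⟩
  take j z ++ at z (suc j) ∷ drop (suc j) z
    ≡⟨ cong (λ r → take j z ++ at z (suc j) ∷ r) (drop-at z (suc j) j<n) ⟩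
  take j z ++ at z (suc j) ∷ at z (2 + j) ∷ drop (2 + j) z ∎
  where open ≡-Reasoning

φ-swapAt-< : ∀ z j → 1 ≤ j → suc j ≤ length z →
  let A = 2 ^ at z j ; B = 2 ^ at z (suc j) ; L = leftWeight z j ; R = rightWeight z j in
  A * L + B * R < A * R + B * L → φ z < φ (swapAt z j)
φ-swapAt-< z j 1≤j j<n gain = subst (λ w → φ w < φ (swapAt z j)) (sym (splitAt z j 1≤j j<n))
  (subst₂ _<_ (cong subtrees (withEnds-split xs a b ys)) (cong subtrees (withEnds-split xs b a ys))
    (subtrees-swap-< (0 ∷ xs) a b (ys ++ [ 0 ]) gain))
  where
  xs ys : List ℕ
  xs = take (j ∸ 1) z
  ys = drop (suc j) z
  a b : ℕ
  a = at z j
  b = at z (suc j)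
  withEnds-split : ∀ xs a b ys → (0 ∷ xs) ++ a ∷ b ∷ ys ++ [ 0 ] ≡ withEnds (xs ++ a ∷ b ∷ ys)
  withEnds-split xs a b ys = cong (0 ∷_) (sym (++-assoc xs (a ∷ b ∷ ys) [ 0 ]))

n<1+2^k*n : ∀ k n → n < suc (2 ^ k * n)
n<1+2^k*n k n = s≤s (m≤n*m n (2 ^ k) {{m^n≢0 2 k}})

leftWeight-increasing : ∀ z j → 1 ≤ j → suc j ≤ length z → leftWeight z j < leftWeight z (suc j)
leftWeight-increasing z j 1≤j j<n
  rewrite take-at z j 1≤j (<⇒≤ j<n) | subtreesToLast-snoc (0 ∷ take (j ∸ 1) z) (at z j) =
  n<1+2^k*n (at z j) (leftWeight z j)

rightWeight-decreasing : ∀ z j → 2 + j ≤ length z → rightWeight z (suc j) < rightWeight z j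
rightWeight-decreasing z j j<n rewrite drop-at z (suc j) j<n =
  n<1+2^k*n (at z (2 + j)) (rightWeight z (suc j))

rightWeight<leftWeight-at-end : ∀ z M → length z ≡ suc M → 2 ≤ M → rightWeight z M < leftWeight z M
rightWeight<leftWeight-at-end (y ∷ t) (suc zero) _ (s≤s ())
rightWeight<leftWeight-at-end (y ∷ t) (suc (suc m)) len≡ _
  rewrite drop-all (2 + m) t (≤-reflexive (suc-injective len≡)) =
  s≤s (+-mono-≤ (m^n>0 2 leaves) (≤-trans (m^n>0 2 leaves) (m≤m+n _ _)))
  where leaves = y + sum (take m t)

-- Sums over bit strings

boolToℕ : Bool → ℕ
boolToℕ true  = 1
boolToℕ false = 0

∑Bits : ℕ → (List Bool → ℕ) → ℕ
∑Bits zero    g = g []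
∑Bits (suc n) g = ∑Bits n (g ∘ (true ∷_)) + ∑Bits n (g ∘ (false ∷_))

∈-map-∷ : ∀ {n b c} {S : Vec Bool n} {L} → b Vec.∷ S ∈ map (c Vec.∷_) L → b ≡ c × S ∈ L
∈-map-∷ b∷S∈ with ∈-map⁻ _ b∷S∈
... | _ , S∈ , refl = refl , S∈

enumerate : ∀ N (f : List Bool → Bool) → ∃ λ (L : List (Vec Bool N)) →
  Unique L × (∀ S → S ∈ L ⇔ f (toList S) ≡ true) × length L ≡ ∑Bits N (boolToℕ ∘ f)
enumerate zero f with f [] in f[]
... | true  = Vec.[] ∷ [] , [] ∷ [] , (λ { Vec.[] → mk⇔ (λ _ → f[]) (λ _ → here refl) }) , refl
... | false = [] , [] , (λ { Vec.[] → mk⇔ (λ ()) λ f[]≡true → contradiction (trans (sym f[]≡true) f[]) λ () }) , refl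
enumerate (suc n) f with enumerate n (f ∘ (true ∷_)) | enumerate n (f ∘ (false ∷_))
... | L₁ , unique₁ , mem₁ , len₁ | L₀ , unique₀ , mem₀ , len₀ = L , unique , mem , len
  where
  L : List (Vec Bool (suc n))
  L = map (true Vec.∷_) L₁ ++ map (false Vec.∷_) L₀

  unique : Unique L
  unique = Unique.++⁺ (Unique.map⁺ ∷-injectiveʳ unique₁) (Unique.map⁺ ∷-injectiveʳ unique₀) disjoint
    where
    disjoint : ∀ {S} → S ∈ map (true Vec.∷_) L₁ × S ∈ map (false Vec.∷_) L₀ → ⊥
    disjoint (S∈₁ , S∈₀) with ∈-map⁻ _ S∈₁
    ... | _ , _ , refl with ∈-map-∷ S∈₀
    ...   | () , _

  sound : ∀ {b S} → b Vec.∷ S ∈ L → f (b ∷ toList S) ≡ true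
  sound b∷S∈ with ∈-++⁻ (map (true Vec.∷_) L₁) b∷S∈
  ... | inj₁ S∈₁ with ∈-map-∷ S∈₁
  ...   | refl , S∈ = Equivalence.to (mem₁ _) S∈
  sound b∷S∈ | inj₂ S∈₀ with ∈-map-∷ S∈₀
  ...   | refl , S∈ = Equivalence.to (mem₀ _) S∈

  complete : ∀ b S → f (b ∷ toList S) ≡ true → b Vec.∷ S ∈ L
  complete true  S accepted = ∈-++⁺ˡ (∈-map⁺ _ (Equivalence.from (mem₁ S) accepted))
  complete false S accepted = ∈-++⁺ʳ _ (∈-map⁺ _ (Equivalence.from (mem₀ S) accepted))

  mem : ∀ S → S ∈ L ⇔ f (toList S) ≡ true
  mem (b Vec.∷ S) = mk⇔ sound (complete b S)

  len : length L ≡ ∑Bits (suc n) (boolToℕ ∘ f)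
  len = begin
    length L                                            ≡⟨ length-++ (map (true Vec.∷_) L₁) ⟩
    length (map (true Vec.∷_) L₁) + length (map (false Vec.∷_) L₀)
      ≡⟨ cong₂ _+_ (trans (length-map _ L₁) len₁) (trans (length-map _ L₀) len₀) ⟩
    ∑Bits (suc n) (boolToℕ ∘ f)                         ∎
    where open ≡-Reasoning

∑Bits-cong : ∀ n {g h : List Bool → ℕ} → (∀ xs → length xs ≡ n → g xs ≡ h xs) →
  ∑Bits n g ≡ ∑Bits n h
∑Bits-cong zero    g≗h = g≗h [] refl
∑Bits-cong (suc n) g≗h = cong₂ _+_ (∑Bits-cong n λ xs len → g≗h (true ∷ xs) (cong suc len))
                                  (∑Bits-cong n λ xs len → g≗h (false ∷ xs) (cong suc len))

∑Bits-distrib-+ : ∀ n (g h : List Bool → ℕ) → ∑Bits n (λ xs → g xs + h xs) ≡ ∑Bits n g + ∑Bits n h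
∑Bits-distrib-+ zero    g h = refl
∑Bits-distrib-+ (suc n) g h
  rewrite ∑Bits-distrib-+ n (g ∘ (true ∷_)) (h ∘ (true ∷_))
        | ∑Bits-distrib-+ n (g ∘ (false ∷_)) (h ∘ (false ∷_)) =
  +-assoc-middle (∑Bits n (g ∘ (true ∷_))) (∑Bits n (h ∘ (true ∷_)))
                 (∑Bits n (g ∘ (false ∷_))) (∑Bits n (h ∘ (false ∷_)))
  where
  +-assoc-middle : ∀ a b c d → a + b + (c + d) ≡ a + c + (b + d)
  +-assoc-middle = solve-∀

∑Bits-distribˡ-* : ∀ n a (g : List Bool → ℕ) → ∑Bits n (λ xs → a * g xs) ≡ a * ∑Bits n g
∑Bits-distribˡ-* zero    a g = refl
∑Bits-distribˡ-* (suc n) a g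
  rewrite ∑Bits-distribˡ-* n a (g ∘ (true ∷_)) | ∑Bits-distribˡ-* n a (g ∘ (false ∷_)) =
  sym (*-distribˡ-+ a _ _)

∑Bits-distribʳ-* : ∀ n a (g : List Bool → ℕ) → ∑Bits n (λ xs → g xs * a) ≡ ∑Bits n g * a
∑Bits-distribʳ-* n a g = begin
  ∑Bits n (λ xs → g xs * a) ≡⟨ ∑Bits-cong n (λ xs _ → *-comm (g xs) a) ⟩
  ∑Bits n (λ xs → a * g xs) ≡⟨ ∑Bits-distribˡ-* n a g ⟩
  a * ∑Bits n g             ≡⟨ *-comm a _ ⟩
  ∑Bits n g * a             ∎
  where open ≡-Reasoning

∑Bits-const : ∀ n a → ∑Bits n (λ _ → a) ≡ 2 ^ n * a
∑Bits-const zero    a = sym (+-identityʳ a)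
∑Bits-const (suc n) a rewrite ∑Bits-const n a = double (2 ^ n) a
  where
  double : ∀ p a → p * a + p * a ≡ (p + (p + 0)) * a
  double = solve-∀

∑Bits-++ : ∀ m n (g : List Bool → ℕ) → ∑Bits (m + n) g ≡ ∑Bits m (λ u → ∑Bits n (λ v → g (u ++ v)))
∑Bits-++ zero    n g = refl
∑Bits-++ (suc m) n g = cong₂ _+_ (∑Bits-++ m n _) (∑Bits-++ m n _)

∑Bits-separate : ∀ l n m (w : List Bool → ℕ) (G : List Bool → List Bool → ℕ) →
  ∑Bits l (λ s → ∑Bits n (λ u → ∑Bits m (λ v → w u * G s v)))
    ≡ ∑Bits n w * ∑Bits l (λ s → ∑Bits m (G s))
∑Bits-separate l n m w G = begin
  ∑Bits l (λ s → ∑Bits n (λ u → ∑Bits m (λ v → w u * G s v)))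
    ≡⟨ ∑Bits-cong l (λ s _ → ∑Bits-cong n λ u _ → ∑Bits-distribˡ-* m (w u) (G s)) ⟩
  ∑Bits l (λ s → ∑Bits n (λ u → w u * ∑Bits m (G s)))
    ≡⟨ ∑Bits-cong l (λ s _ → ∑Bits-distribʳ-* n (∑Bits m (G s)) w) ⟩
  ∑Bits l (λ s → ∑Bits n w * ∑Bits m (G s))
    ≡⟨ ∑Bits-distribˡ-* l (∑Bits n w) (λ s → ∑Bits m (G s)) ⟩
  ∑Bits n w * ∑Bits l (λ s → ∑Bits m (G s)) ∎
  where open ≡-Reasoning

noneᵇ exactlyOneᵇ : List Bool → Bool
noneᵇ []           = true
noneᵇ (true ∷ _)   = false
noneᵇ (false ∷ xs) = noneᵇ xs
exactlyOneᵇ []           = false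
exactlyOneᵇ (true ∷ xs)  = noneᵇ xs
exactlyOneᵇ (false ∷ xs) = exactlyOneᵇ xs

∑Bits-noneᵇ : ∀ n → ∑Bits n (boolToℕ ∘ noneᵇ) ≡ 1
∑Bits-noneᵇ zero    = refl
∑Bits-noneᵇ (suc n) = trans (cong (_+ ∑Bits n (boolToℕ ∘ noneᵇ)) (trans (∑Bits-const n 0) (*-zeroʳ (2 ^ n))))
                            (∑Bits-noneᵇ n)

∑Bits-exactlyOneᵇ : ∀ n → ∑Bits n (boolToℕ ∘ exactlyOneᵇ) ≡ n
∑Bits-exactlyOneᵇ zero    = refl
∑Bits-exactlyOneᵇ (suc n) = cong₂ _+_ (∑Bits-noneᵇ n) (∑Bits-exactlyOneᵇ n)

-- A recogniser for subtrees

-- For each spine vertex in turn, run reads its bit and then the block of bits of its leaves.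
-- notStarted: nothing chosen yet; growing: the previous spine vertex is chosen;
-- finished: nothing more may be chosen.
data State : Set where
  notStarted growing finished : State

data BlockRule : Set where
  anyLeaves noLeaves : State → BlockRule
  noneOrOneLeaf      : State → State → BlockRule
  reject             : BlockRule

transition : State → Bool → BlockRule
transition notStarted true  = anyLeaves growing
transition notStarted false = noneOrOneLeaf notStarted finished
transition growing    true  = anyLeaves growing
transition growing    false = noLeaves finished
transition finished   true  = reject
transition finished   false = noLeaves finished

applyRule : BlockRule → List Bool → (State → Bool) → Bool
applyRule (anyLeaves q)         b K = K q
applyRule (noLeaves q)          b K = noneᵇ b ∧ K q
applyRule (noneOrOneLeaf q₀ q₁) b K = if noneᵇ b then K q₀ else (exactlyOneᵇ b ∧ K q₁)
applyRule reject                b K = false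

accepting : State → Bool
accepting notStarted = false
accepting growing    = true
accepting finished   = true

run : List ℕ → State → List Bool → List Bool → Bool
run []       q ss       ls = accepting q
run (c ∷ cs) q []       ls = false
run (c ∷ cs) q (s ∷ ss) ls = applyRule (transition q s) (take c ls) (λ q′ → run cs q′ ss (drop c ls))

acceptedCount : List ℕ → State → ℕ
acceptedCount cs q = ∑Bits (length cs) (λ ss → ∑Bits (sum cs) (λ ls → boolToℕ (run cs q ss ls)))

closedForm : List ℕ → State → ℕ
closedForm cs notStarted = subtrees cs
closedForm cs growing    = suc (subtreesFromFirst cs)
closedForm cs finished   = 1

ruleCount : BlockRule → ℕ → (State → ℕ) → ℕ
ruleCount (anyLeaves q)         c f = 2 ^ c * f q
ruleCount (noLeaves q)          c f = f q
ruleCount (noneOrOneLeaf q₀ q₁) c f = f q₀ + c * f q₁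
ruleCount reject                c f = 0

ruleCount-cong : ∀ r c {f g : State → ℕ} → (∀ q → f q ≡ g q) → ruleCount r c f ≡ ruleCount r c g
ruleCount-cong (anyLeaves q)         c f≗g = cong (2 ^ c *_) (f≗g q)
ruleCount-cong (noLeaves q)          c f≗g = f≗g q
ruleCount-cong (noneOrOneLeaf q₀ q₁) c f≗g = cong₂ (λ m n → m + c * n) (f≗g q₀) (f≗g q₁)
ruleCount-cong reject                c f≗g = refl

-- boolToℕ ∘ applyRule written as a sum of weight × value, to be summed by ∑Bits-separate.
ruleWeight : BlockRule → List Bool → (State → ℕ) → ℕ
ruleWeight (anyLeaves q)         b f = 1 * f q
ruleWeight (noLeaves q)          b f = boolToℕ (noneᵇ b) * f q
ruleWeight (noneOrOneLeaf q₀ q₁) b f = boolToℕ (noneᵇ b) * f q₀ + boolToℕ (exactlyOneᵇ b) * f q₁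
ruleWeight reject                b f = 0 * f notStarted

boolToℕ-∧ : ∀ a b → boolToℕ (a ∧ b) ≡ boolToℕ a * boolToℕ b
boolToℕ-∧ true  b = sym (+-identityʳ _)
boolToℕ-∧ false b = refl

noneᵇ⇒¬exactlyOneᵇ : ∀ b → noneᵇ b ≡ true → exactlyOneᵇ b ≡ false
noneᵇ⇒¬exactlyOneᵇ []          _    = refl
noneᵇ⇒¬exactlyOneᵇ (false ∷ b) none = noneᵇ⇒¬exactlyOneᵇ b none

applyRule-weight : ∀ r b (K : State → Bool) → boolToℕ (applyRule r b K) ≡ ruleWeight r b (boolToℕ ∘ K)
applyRule-weight (anyLeaves q)         b K = sym (*-identityˡ _)
applyRule-weight (noLeaves q)          b K = boolToℕ-∧ (noneᵇ b) (K q)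
applyRule-weight (noneOrOneLeaf q₀ q₁) b K with noneᵇ b in none
... | true  rewrite noneᵇ⇒¬exactlyOneᵇ b none = sym (trans (+-identityʳ _) (+-identityʳ _))
... | false = boolToℕ-∧ (exactlyOneᵇ b) (K q₁)
applyRule-weight reject                b K = refl

module _ (l c m : ℕ) (G : State → List Bool → List Bool → ℕ) where

  private
    F : State → ℕ
    F q = ∑Bits l (λ s → ∑Bits m (G q s))
    w₀ w₁ : List Bool → ℕ
    w₀ = boolToℕ ∘ noneᵇ
    w₁ = boolToℕ ∘ exactlyOneᵇ

  ruleWeight-sum : ∀ r →
    ∑Bits l (λ s → ∑Bits c (λ b → ∑Bits m (λ v → ruleWeight r b (λ q → G q s v))))
      ≡ ruleCount r c (λ q → ∑Bits l (λ s → ∑Bits m (G q s)))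
  ruleWeight-sum (anyLeaves q) =
    trans (∑Bits-separate l c m (λ _ → 1) (G q)) (cong (_* F q) (trans (∑Bits-const c 1) (*-identityʳ (2 ^ c))))
  ruleWeight-sum (noLeaves q) =
    trans (∑Bits-separate l c m w₀ (G q)) (trans (cong (_* F q) (∑Bits-noneᵇ c)) (*-identityˡ _))
  ruleWeight-sum (noneOrOneLeaf q₀ q₁) = begin
    ∑Bits l (λ s → ∑Bits c (λ b → ∑Bits m (λ v → w₀ b * G q₀ s v + w₁ b * G q₁ s v)))
      ≡⟨ ∑Bits-cong l (λ s _ → trans (∑Bits-cong c λ b _ → ∑Bits-distrib-+ m _ _) (∑Bits-distrib-+ c _ _)) ⟩
    ∑Bits l (λ s → ∑Bits c (λ b → ∑Bits m (λ v → w₀ b * G q₀ s v))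
                 + ∑Bits c (λ b → ∑Bits m (λ v → w₁ b * G q₁ s v)))
      ≡⟨ ∑Bits-distrib-+ l _ _ ⟩
    ∑Bits l (λ s → ∑Bits c (λ b → ∑Bits m (λ v → w₀ b * G q₀ s v)))
      + ∑Bits l (λ s → ∑Bits c (λ b → ∑Bits m (λ v → w₁ b * G q₁ s v)))
      ≡⟨ cong₂ _+_ (∑Bits-separate l c m w₀ (G q₀)) (∑Bits-separate l c m w₁ (G q₁)) ⟩
    ∑Bits c w₀ * F q₀ + ∑Bits c w₁ * F q₁
      ≡⟨ cong₂ _+_ (trans (cong (_* F q₀) (∑Bits-noneᵇ c)) (*-identityˡ _))
                   (cong (_* F q₁) (∑Bits-exactlyOneᵇ c)) ⟩
    F q₀ + c * F q₁ ∎
    where open ≡-Reasoning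
  ruleWeight-sum reject =
    trans (∑Bits-separate l c m (λ _ → 0) (G notStarted))
          (cong (_* F notStarted) (trans (∑Bits-const c 0) (*-zeroʳ (2 ^ c))))

take-++ : ∀ {A : Set} n (u v : List A) → length u ≡ n → take n (u ++ v) ≡ u
take-++ _ []      v refl = refl
take-++ _ (x ∷ u) v refl = cong (x ∷_) (take-++ _ u v refl)

drop-++ : ∀ {A : Set} n (u v : List A) → length u ≡ n → drop n (u ++ v) ≡ v
drop-++ _ []      v refl = refl
drop-++ _ (x ∷ u) v refl = drop-++ _ u v refl

acceptedCount-block : ∀ c cs r →
  ∑Bits (length cs) (λ ss → ∑Bits (c + sum cs) (λ ls →
    boolToℕ (applyRule r (take c ls) (λ q′ → run cs q′ ss (drop c ls)))))
  ≡ ruleCount r c (acceptedCount cs)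
acceptedCount-block c cs r = begin
  ∑Bits l (λ ss → ∑Bits (c + m) (λ ls →
    boolToℕ (applyRule r (take c ls) (λ q′ → run cs q′ ss (drop c ls)))))
    ≡⟨ ∑Bits-cong l (λ ss _ → trans (∑Bits-++ c m _) (∑Bits-cong c λ b len → ∑Bits-cong m λ v _ →
         trans (cong₂ (λ b′ v′ → boolToℕ (applyRule r b′ (λ q′ → run cs q′ ss v′)))
                      (take-++ c b v len) (drop-++ c b v len))
               (applyRule-weight r b (λ q′ → run cs q′ ss v)))) ⟩
  ∑Bits l (λ ss → ∑Bits c (λ b → ∑Bits m (λ v → ruleWeight r b (λ q → boolToℕ (run cs q ss v)))))
    ≡⟨ ruleWeight-sum l c m (λ q ss v → boolToℕ (run cs q ss v)) r ⟩
  ruleCount r c (acceptedCount cs) ∎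
  where
  open ≡-Reasoning
  l m : ℕ
  l = length cs
  m = sum cs

closedForm-step : ∀ c cs q →
  ruleCount (transition q true) c (closedForm cs) + ruleCount (transition q false) c (closedForm cs)
    ≡ closedForm (c ∷ cs) q
closedForm-step c cs notStarted =
  trans (cong (λ n → 2 ^ c * suc (subtreesFromFirst cs) + (subtrees cs + n)) (*-identityʳ c))
        (sym (+-assoc (2 ^ c * suc (subtreesFromFirst cs)) (subtrees cs) c))
closedForm-step c cs growing    = +-comm _ 1
closedForm-step c cs finished   = refl

acceptedCount≡closedForm : ∀ cs q → acceptedCount cs q ≡ closedForm cs q
acceptedCount≡closedForm []         notStarted = refl
acceptedCount≡closedForm []         growing    = refl
acceptedCount≡closedForm []         finished   = refl
acceptedCount≡closedForm (c ∷ cs) q = begin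
  acceptedCount (c ∷ cs) q
    ≡⟨ cong₂ _+_ (acceptedCount-block c cs (transition q true)) (acceptedCount-block c cs (transition q false)) ⟩
  ruleCount (transition q true) c (acceptedCount cs) + ruleCount (transition q false) c (acceptedCount cs)
    ≡⟨ cong₂ _+_ (ruleCount-cong (transition q true) c (acceptedCount≡closedForm cs))
                 (ruleCount-cong (transition q false) c (acceptedCount≡closedForm cs)) ⟩
  ruleCount (transition q true) c (closedForm cs) + ruleCount (transition q false) c (closedForm cs)
    ≡⟨ closedForm-step c cs q ⟩
  closedForm (c ∷ cs) q ∎
  where open ≡-Reasoning

-- Vertex numbering of catEdges: the k + 2 spine bits come first, then the leaf bits
-- in the order of their spine vertices.
isSubtreeᵇ : List ℕ → List Bool → Bool
isSubtreeᵇ z xs = run (withEnds z) notStarted (take (length z + 2) xs) (drop (length z + 2) xs)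

length-withEnds : ∀ z → length (withEnds z) ≡ length z + 2
length-withEnds []      = refl
length-withEnds (_ ∷ z) = cong suc (length-withEnds z)

sum-withEnds : ∀ z → sum (withEnds z) ≡ sum z
sum-withEnds []      = refl
sum-withEnds (x ∷ z) = cong (x +_) (sum-withEnds z)

∑Bits-isSubtreeᵇ : ∀ z → ∑Bits (catN z) (boolToℕ ∘ isSubtreeᵇ z) ≡ φ z
∑Bits-isSubtreeᵇ z = begin
  ∑Bits (n + sum z) (boolToℕ ∘ isSubtreeᵇ z)
    ≡⟨ ∑Bits-++ n (sum z) _ ⟩
  ∑Bits n (λ u → ∑Bits (sum z) (λ v → boolToℕ (isSubtreeᵇ z (u ++ v))))
    ≡⟨ ∑Bits-cong n (λ u len → ∑Bits-cong (sum z) λ v _ →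
         cong₂ (λ u′ v′ → boolToℕ (run (withEnds z) notStarted u′ v′))
               (take-++ n u v len) (drop-++ n u v len)) ⟩
  ∑Bits n (λ u → ∑Bits (sum z) (λ v → boolToℕ (run (withEnds z) notStarted u v)))
    ≡⟨ cong₂ (λ n′ m′ → ∑Bits n′ (λ u → ∑Bits m′ (λ v → boolToℕ (run (withEnds z) notStarted u v))))
         (length-withEnds z) (sum-withEnds z) ⟨
  acceptedCount (withEnds z) notStarted
    ≡⟨ acceptedCount≡closedForm (withEnds z) notStarted ⟩
  φ z ∎
  where
  open ≡-Reasoning
  n : ℕ
  n = length z + 2

-- Leaves are numbered block by block; owner cs p is the spine position of leaf p.
owner : List ℕ → ℕ → ℕ
ownerPast : ℕ → List ℕ → ℕ → ℕ
owner []       p = 0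
owner (c ∷ cs) p = ownerPast c cs p
ownerPast zero    cs p       = suc (owner cs p)
ownerPast (suc c) cs zero    = 0
ownerPast (suc c) cs (suc p) = ownerPast c cs p

owner-< : ∀ c cs p → p < c → owner (c ∷ cs) p ≡ 0
owner-< (suc c) cs zero    _         = refl
owner-< (suc c) cs (suc p) (s≤s p<c) = owner-< c cs p p<c

owner-+ : ∀ c cs p → owner (c ∷ cs) (c + p) ≡ suc (owner cs p)
owner-+ zero    cs p = refl
owner-+ (suc c) cs p = owner-+ c cs p

<⊎+ : ∀ c p → p < c ⊎ ∃ λ p′ → p ≡ c + p′
<⊎+ zero    p       = inj₂ (p , refl)
<⊎+ (suc c) zero    = inj₁ (s≤s z≤n)
<⊎+ (suc c) (suc p) with <⊎+ c p
... | inj₁ p<c        = inj₁ (s≤s p<c)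
... | inj₂ (p′ , refl) = inj₂ (p′ , refl)

atB-take : ∀ c ls p → p < c → atB (take c ls) p ≡ atB ls p
atB-take (suc c) []       p       _         = refl
atB-take (suc c) (x ∷ ls) zero    _         = refl
atB-take (suc c) (x ∷ ls) (suc p) (s≤s p<c) = atB-take c ls p p<c

atB-take-true⇒< : ∀ c ls p → atB (take c ls) p ≡ true → p < c
atB-take-true⇒< (suc c) (x ∷ ls) zero    _      = s≤s z≤n
atB-take-true⇒< (suc c) (x ∷ ls) (suc p) chosen = s≤s (atB-take-true⇒< c ls p chosen)

atB-drop : ∀ c ls p → atB (drop c ls) p ≡ atB ls (c + p)
atB-drop zero    ls       p = refl
atB-drop (suc c) []       p = refl
atB-drop (suc c) (x ∷ ls) p = atB-drop c ls p

atB-true⇒< : ∀ ls p → atB ls p ≡ true → p < length ls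
atB-true⇒< (x ∷ ls) zero    _      = s≤s z≤n
atB-true⇒< (x ∷ ls) (suc p) chosen = s≤s (atB-true⇒< ls p chosen)

AllFalse : List Bool → Set
AllFalse bs = ∀ p → atB bs p ≡ false

ExactlyOneTrue : List Bool → Set
ExactlyOneTrue bs = ∃ λ p → atB bs p ≡ true × (∀ q → atB bs q ≡ true → q ≡ p)

∧≡true : ∀ {a b} → a ∧ b ≡ true → a ≡ true × b ≡ true
∧≡true {true} b≡true = refl , b≡true

noneᵇ-sound : ∀ bs → noneᵇ bs ≡ true → AllFalse bs
noneᵇ-sound []           _    p       = refl
noneᵇ-sound (false ∷ bs) none zero    = refl
noneᵇ-sound (false ∷ bs) none (suc p) = noneᵇ-sound bs none p

noneᵇ-complete : ∀ bs → AllFalse bs → noneᵇ bs ≡ true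
noneᵇ-complete []           _       = refl
noneᵇ-complete (true ∷ bs)  allFalse = contradiction (allFalse 0) λ ()
noneᵇ-complete (false ∷ bs) allFalse = noneᵇ-complete bs (allFalse ∘ suc)

noneᵇ≡false⇒∃true : ∀ bs → noneᵇ bs ≡ false → ∃ λ j → atB bs j ≡ true
noneᵇ≡false⇒∃true (true ∷ _)   _    = 0 , refl
noneᵇ≡false⇒∃true (false ∷ bs) some with noneᵇ≡false⇒∃true bs some
... | j , chosen = suc j , chosen

exactlyOneᵇ-sound : ∀ bs → exactlyOneᵇ bs ≡ true → ExactlyOneTrue bs
exactlyOneᵇ-sound (true ∷ bs) none = 0 , refl , λ where
  zero    _      → refl
  (suc q) chosen → contradiction (trans (sym chosen) (noneᵇ-sound bs none q)) λ ()
exactlyOneᵇ-sound (false ∷ bs) one with exactlyOneᵇ-sound bs one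
... | p , chosen , unique = suc p , chosen , λ where
  zero    ()
  (suc q) chosen′ → cong suc (unique q chosen′)

exactlyOneᵇ-complete : ∀ bs → ExactlyOneTrue bs → exactlyOneᵇ bs ≡ true
exactlyOneᵇ-complete (true ∷ bs)  (zero , _ , unique) =
  noneᵇ-complete bs λ q → ¬-not λ chosen → contradiction (unique (suc q) chosen) λ ()
exactlyOneᵇ-complete (true ∷ bs)  (suc p , _ , unique) = contradiction (unique 0 refl) λ ()
exactlyOneᵇ-complete (false ∷ bs) (suc p , chosen , unique) =
  exactlyOneᵇ-complete bs (p , chosen , λ q chosen′ → suc-injective (unique (suc q) chosen′))

AllFalse-take : ∀ c ls → AllFalse ls → AllFalse (take c ls)
AllFalse-take zero    ls       _        p       = refl
AllFalse-take (suc c) []       _        p       = refl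
AllFalse-take (suc c) (x ∷ ls) allFalse zero    = allFalse 0
AllFalse-take (suc c) (x ∷ ls) allFalse (suc p) = AllFalse-take c ls (allFalse ∘ suc) p

AllFalse-drop : ∀ c ls → AllFalse ls → AllFalse (drop c ls)
AllFalse-drop c ls allFalse p = trans (atB-drop c ls p) (allFalse (c + p))

AllFalse-take-drop : ∀ c ls → AllFalse (take c ls) → AllFalse (drop c ls) → AllFalse ls
AllFalse-take-drop c ls inBlock inRest p with <⊎+ c p
... | inj₁ p<c         = trans (sym (atB-take c ls p p<c)) (inBlock p)
... | inj₂ (p′ , refl) = trans (sym (atB-drop c ls p′)) (inRest p′)

record Fits (cs : List ℕ) (ss ls : List Bool) : Set where
  constructor fits⟨_,_⟩
  field
    spine-length : length ss ≡ length cs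
    leaves-length : length ls ≡ sum cs

Fits-rest : ∀ {c cs s ss} ls → Fits (c ∷ cs) (s ∷ ss) ls → Fits cs ss (drop c ls)
Fits-rest {c} ls fits⟨ len-ss , len-ls ⟩ =
  fits⟨ suc-injective len-ss , trans (length-drop c ls) (trans (cong (_∸ c) len-ls) (m+n∸m≡n c _)) ⟩

AllFalse-∷ : ∀ {ss} → AllFalse ss → AllFalse (false ∷ ss)
AllFalse-∷ allFalse zero    = refl
AllFalse-∷ allFalse (suc p) = allFalse p

NothingChosen : List Bool → List Bool → Set
NothingChosen ss ls = AllFalse ss × AllFalse ls

finished-sound : ∀ cs ss ls → Fits cs ss ls → run cs finished ss ls ≡ true → NothingChosen ss ls
finished-sound []       []           []       _   _        = (λ _ → refl) , (λ _ → refl)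
finished-sound (c ∷ cs) (false ∷ ss) ls       fit accepted with ∧≡true {noneᵇ (take c ls)} accepted
... | blockEmpty , restAccepted with finished-sound cs ss (drop c ls) (Fits-rest ls fit) restAccepted
...   | ssFalse , restFalse =
  AllFalse-∷ ssFalse , AllFalse-take-drop c ls (noneᵇ-sound (take c ls) blockEmpty) restFalse

finished-complete : ∀ cs ss ls → Fits cs ss ls → NothingChosen ss ls → run cs finished ss ls ≡ true
finished-complete []       ss       ls _   _ = refl
finished-complete (c ∷ cs) (s ∷ ss) ls fit (ssFalse , lsFalse)
  rewrite ssFalse 0 | noneᵇ-complete (take c ls) (AllFalse-take c ls lsFalse) =
  finished-complete cs ss (drop c ls) (Fits-rest ls fit) (ssFalse ∘ suc , AllFalse-drop c ls lsFalse)

GrowingShape : List ℕ → List Bool → List Bool → Set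
GrowingShape cs ss ls = ∃ λ m → m ≤ length cs
  × (∀ i → atB ss i ≡ true → i < m) × (∀ i → i < m → atB ss i ≡ true)
  × (∀ p → atB ls p ≡ true → owner cs p < m)

growing-sound : ∀ cs ss ls → Fits cs ss ls → run cs growing ss ls ≡ true → GrowingShape cs ss ls
growing-sound []       []          []       _   _        = 0 , z≤n , (λ _ ()) , (λ _ ()) , (λ _ ())
growing-sound (c ∷ cs) (true ∷ ss) ls       fit accepted
  with growing-sound cs ss (drop c ls) (Fits-rest ls fit) accepted
... | m , m≤ , spine⊆ , spine⊇ , leaves = suc m , s≤s m≤ , spine⊆′ , spine⊇′ , leaves′
  where
  spine⊆′ : ∀ i → atB (true ∷ ss) i ≡ true → i < suc m
  spine⊆′ zero    _      = s≤s z≤n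
  spine⊆′ (suc i) chosen = s≤s (spine⊆ i chosen)
  spine⊇′ : ∀ i → i < suc m → atB (true ∷ ss) i ≡ true
  spine⊇′ zero    _         = refl
  spine⊇′ (suc i) (s≤s i<m) = spine⊇ i i<m
  leaves′ : ∀ p → atB ls p ≡ true → owner (c ∷ cs) p < suc m
  leaves′ p chosen with <⊎+ c p
  ... | inj₁ p<c rewrite owner-< c cs p p<c = s≤s z≤n
  ... | inj₂ (p′ , refl) rewrite owner-+ c cs p′ = s≤s (leaves p′ (trans (atB-drop c ls p′) chosen))
growing-sound (c ∷ cs) (false ∷ ss) ls fit accepted with ∧≡true {noneᵇ (take c ls)} accepted
... | blockEmpty , restAccepted with finished-sound cs ss (drop c ls) (Fits-rest ls fit) restAccepted
...   | ssFalse , restFalse = 0 , z≤n , spine⊆ , (λ _ ()) , leaves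
  where
  spine⊆ : ∀ i → atB (false ∷ ss) i ≡ true → i < 0
  spine⊆ (suc i) chosen = contradiction (trans (sym chosen) (ssFalse i)) λ ()
  leaves : ∀ p → atB ls p ≡ true → owner (c ∷ cs) p < 0
  leaves p chosen = contradiction
    (trans (sym chosen) (AllFalse-take-drop c ls (noneᵇ-sound (take c ls) blockEmpty) restFalse p)) λ ()

growing-accepts-nothing : ∀ cs ss ls → Fits cs ss ls → NothingChosen ss ls → run cs growing ss ls ≡ true
growing-accepts-nothing []       ss       ls _   _ = refl
growing-accepts-nothing (c ∷ cs) (s ∷ ss) ls fit (ssFalse , lsFalse)
  rewrite ssFalse 0 | noneᵇ-complete (take c ls) (AllFalse-take c ls lsFalse) =
  finished-complete cs ss (drop c ls) (Fits-rest ls fit) (ssFalse ∘ suc , AllFalse-drop c ls lsFalse)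

growing-complete : ∀ cs ss ls → Fits cs ss ls → GrowingShape cs ss ls → run cs growing ss ls ≡ true
growing-complete []       ss       ls _   _ = refl
growing-complete (c ∷ cs) ss ls fit (zero , _ , spine⊆ , _ , leaves) =
  growing-accepts-nothing (c ∷ cs) ss ls fit
    ((λ i → ¬-not λ chosen → contradiction (spine⊆ i chosen) λ ()) ,
     (λ p → ¬-not λ chosen → contradiction (leaves p chosen) λ ()))
growing-complete (c ∷ cs) (false ∷ ss) ls fit (suc m , _ , _ , spine⊇ , _) = contradiction (spine⊇ 0 (s≤s z≤n)) λ ()
growing-complete (c ∷ cs) (true ∷ ss) ls fit (suc m , m≤ , spine⊆ , spine⊇ , leaves) =
  growing-complete cs ss (drop c ls) (Fits-rest ls fit)
  (m , s≤s⁻¹ m≤ , (λ i chosen → s≤s⁻¹ (spine⊆ (suc i) chosen)) , (λ i i<m → spine⊇ (suc i) (s≤s i<m)) ,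
   λ p chosen → s≤s⁻¹ (subst (_< suc m) (owner-+ c cs p) (leaves (c + p) (trans (sym (atB-drop c ls p)) chosen))))

SpineInterval : ℕ → ℕ → List Bool → Set
SpineInterval a b ss =
  (∀ i → atB ss i ≡ true → a ≤ i × i ≤ b) × (∀ i → a ≤ i → i ≤ b → atB ss i ≡ true)

LeavesWithin : ℕ → ℕ → List ℕ → List Bool → Set
LeavesWithin a b cs ls = ∀ p → atB ls p ≡ true → a ≤ owner cs p × owner cs p ≤ b

data SubtreeShape (cs : List ℕ) (ss ls : List Bool) : Set where
  singleLeaf   : AllFalse ss → ExactlyOneTrue ls → SubtreeShape cs ss ls
  spineSegment : ∀ a b → a ≤ b → b < length cs → SpineInterval a b ss → LeavesWithin a b cs ls →
                 SubtreeShape cs ss ls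

module _ {c : ℕ} {cs : List ℕ} {ss : List Bool} (ls : List Bool) where

  chosen-in-rest : AllFalse (take c ls) → ∀ p → atB ls p ≡ true →
    ∃ λ p′ → p ≡ c + p′ × atB (drop c ls) p′ ≡ true
  chosen-in-rest blockFalse p chosen with <⊎+ c p
  ... | inj₁ p<c = contradiction (trans (sym chosen) (trans (sym (atB-take c ls p p<c)) (blockFalse p))) λ ()
  ... | inj₂ (p′ , refl) = p′ , refl , trans (atB-drop c ls p′) chosen

  SubtreeShape-skip⁺ : AllFalse (take c ls) → SubtreeShape cs ss (drop c ls) → SubtreeShape (c ∷ cs) (false ∷ ss) ls
  SubtreeShape-skip⁺ blockFalse (singleLeaf ssFalse (p , chosen , unique)) =
    singleLeaf (AllFalse-∷ ssFalse) (c + p , trans (sym (atB-drop c ls p)) chosen , unique′)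
    where
    unique′ : ∀ q → atB ls q ≡ true → q ≡ c + p
    unique′ q chosen′ with chosen-in-rest blockFalse q chosen′
    ... | q′ , refl , chosen″ = cong (c +_) (unique q′ chosen″)
  SubtreeShape-skip⁺ blockFalse (spineSegment a b a≤b b< (spine⊆ , spine⊇) leaves) =
    spineSegment (suc a) (suc b) (s≤s a≤b) (s≤s b<) (spine⊆′ , spine⊇′) leaves′
    where
    spine⊆′ : ∀ i → atB (false ∷ ss) i ≡ true → suc a ≤ i × i ≤ suc b
    spine⊆′ (suc i) chosen = Product.map s≤s s≤s (spine⊆ i chosen)
    spine⊇′ : ∀ i → suc a ≤ i → i ≤ suc b → atB (false ∷ ss) i ≡ true
    spine⊇′ (suc i) (s≤s a≤i) (s≤s i≤b) = spine⊇ i a≤i i≤b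
    leaves′ : LeavesWithin (suc a) (suc b) (c ∷ cs) ls
    leaves′ p chosen with chosen-in-rest blockFalse p chosen
    ... | p′ , refl , chosen′ rewrite owner-+ c cs p′ = Product.map s≤s s≤s (leaves p′ chosen′)

  SubtreeShape-skip⁻ : AllFalse (take c ls) → SubtreeShape (c ∷ cs) (false ∷ ss) ls → SubtreeShape cs ss (drop c ls)
  SubtreeShape-skip⁻ blockFalse (singleLeaf ssFalse (p , chosen , unique))
    with chosen-in-rest blockFalse p chosen
  ... | p′ , refl , chosen′ = singleLeaf (ssFalse ∘ suc) (p′ , chosen′ , unique′)
    where
    unique′ : ∀ q → atB (drop c ls) q ≡ true → q ≡ p′
    unique′ q chosen″ = +-cancelˡ-≡ c _ _ (unique (c + q) (trans (sym (atB-drop c ls q)) chosen″))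
  SubtreeShape-skip⁻ _ (spineSegment zero b _ _ (_ , spine⊇) _) = contradiction (spine⊇ 0 z≤n z≤n) λ ()
  SubtreeShape-skip⁻ _ (spineSegment (suc a) (suc b) a≤b b< (spine⊆ , spine⊇) leaves) =
    spineSegment a b (s≤s⁻¹ a≤b) (s≤s⁻¹ b<) (spine⊆′ , λ i a≤i i≤b → spine⊇ (suc i) (s≤s a≤i) (s≤s i≤b)) leaves′
    where
    spine⊆′ : ∀ i → atB ss i ≡ true → a ≤ i × i ≤ b
    spine⊆′ i chosen = Product.map s≤s⁻¹ s≤s⁻¹ (spine⊆ (suc i) chosen)
    leaves′ : LeavesWithin a b cs (drop c ls)
    leaves′ p chosen = Product.map s≤s⁻¹ s≤s⁻¹ (subst (λ o → suc a ≤ o × o ≤ suc b) (owner-+ c cs p)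
      (leaves (c + p) (trans (sym (atB-drop c ls p)) chosen)))

  SubtreeShape-start⁺ : GrowingShape cs ss (drop c ls) → SubtreeShape (c ∷ cs) (true ∷ ss) ls
  SubtreeShape-start⁺ (m , m≤ , spine⊆ , spine⊇ , leaves) = spineSegment 0 m z≤n (s≤s m≤) (spine⊆′ , spine⊇′) leaves′
    where
    spine⊆′ : ∀ i → atB (true ∷ ss) i ≡ true → 0 ≤ i × i ≤ m
    spine⊆′ zero    _      = z≤n , z≤n
    spine⊆′ (suc i) chosen = z≤n , spine⊆ i chosen
    spine⊇′ : ∀ i → 0 ≤ i → i ≤ m → atB (true ∷ ss) i ≡ true
    spine⊇′ zero    _ _   = refl
    spine⊇′ (suc i) _ i<m = spine⊇ i i<m
    leaves′ : LeavesWithin 0 m (c ∷ cs) ls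
    leaves′ p chosen with <⊎+ c p
    ... | inj₁ p<c rewrite owner-< c cs p p<c = z≤n , z≤n
    ... | inj₂ (p′ , refl) rewrite owner-+ c cs p′ = z≤n , leaves p′ (trans (atB-drop c ls p′) chosen)

  SubtreeShape-start⁻ : SubtreeShape (c ∷ cs) (true ∷ ss) ls → GrowingShape cs ss (drop c ls)
  SubtreeShape-start⁻ (singleLeaf ssFalse _) = contradiction (ssFalse 0) λ ()
  SubtreeShape-start⁻ (spineSegment (suc a) _ _ _ (spine⊆ , _) _) = contradiction (proj₁ (spine⊆ 0 refl)) λ ()
  SubtreeShape-start⁻ (spineSegment zero b _ b< (spine⊆ , spine⊇) leaves) =
    b , s≤s⁻¹ b< , (λ i chosen → proj₂ (spine⊆ (suc i) chosen)) , (λ i i<b → spine⊇ (suc i) z≤n i<b) ,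
    λ p chosen → subst (_≤ b) (owner-+ c cs p) (proj₂ (leaves (c + p) (trans (sym (atB-drop c ls p)) chosen)))

  SubtreeShape-leafInBlock⁺ : ExactlyOneTrue (take c ls) → NothingChosen ss (drop c ls) →
    SubtreeShape (c ∷ cs) (false ∷ ss) ls
  SubtreeShape-leafInBlock⁺ (p , chosen , unique) (ssFalse , restFalse) =
    singleLeaf (AllFalse-∷ ssFalse) (p , trans (sym (atB-take c ls p p<c)) chosen , unique′)
    where
    p<c : p < c
    p<c = atB-take-true⇒< c ls p chosen
    unique′ : ∀ q → atB ls q ≡ true → q ≡ p
    unique′ q chosen′ with <⊎+ c q
    ... | inj₁ q<c = unique q (trans (atB-take c ls q q<c) chosen′)
    ... | inj₂ (q′ , refl) = contradiction (trans (sym chosen′) (trans (sym (atB-drop c ls q′)) (restFalse q′))) λ ()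

  SubtreeShape-leafInBlock⁻ : noneᵇ (take c ls) ≡ false → SubtreeShape (c ∷ cs) (false ∷ ss) ls →
    ExactlyOneTrue (take c ls) × NothingChosen ss (drop c ls)
  SubtreeShape-leafInBlock⁻ someLeaf shape with noneᵇ≡false⇒∃true (take c ls) someLeaf
  ... | q , chosenᵠ with atB-take-true⇒< c ls q chosenᵠ | shape
  ...   | q<c | singleLeaf ssFalse (p , chosen , unique) with unique q (trans (sym (atB-take c ls q q<c)) chosenᵠ)
  ...     | refl = (p , chosenᵠ , uniqueInBlock) , ssFalse ∘ suc , restFalse
    where
    uniqueInBlock : ∀ r → atB (take c ls) r ≡ true → r ≡ p
    uniqueInBlock r chosenʳ = unique r (trans (sym (atB-take c ls r (atB-take-true⇒< c ls r chosenʳ))) chosenʳ)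
    restFalse : AllFalse (drop c ls)
    restFalse r = ¬-not λ chosenʳ →
      <⇒≱ q<c (subst (c ≤_) (unique (c + r) (trans (sym (atB-drop c ls r)) chosenʳ)) (m≤m+n c r))
  SubtreeShape-leafInBlock⁻ _ _ | _ | _ | spineSegment zero _ _ _ (_ , spine⊇) _ =
    contradiction (spine⊇ 0 z≤n z≤n) λ ()
  SubtreeShape-leafInBlock⁻ _ _ | q , chosenᵠ | q<c | spineSegment (suc a) _ _ _ _ leaves =
    contradiction (subst (suc a ≤_) (owner-< c cs q q<c)
                         (proj₁ (leaves q (trans (sym (atB-take c ls q q<c)) chosenᵠ)))) λ ()

subtree-sound : ∀ cs ss ls → Fits cs ss ls → run cs notStarted ss ls ≡ true → SubtreeShape cs ss ls
subtree-sound (c ∷ cs) (true ∷ ss) ls fit accepted =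
  SubtreeShape-start⁺ ls (growing-sound cs ss (drop c ls) (Fits-rest ls fit) accepted)
subtree-sound (c ∷ cs) (false ∷ ss) ls fit accepted with noneᵇ (take c ls) in none
... | true  = SubtreeShape-skip⁺ ls (noneᵇ-sound (take c ls) none)
                (subtree-sound cs ss (drop c ls) (Fits-rest ls fit) accepted)
... | false with ∧≡true {exactlyOneᵇ (take c ls)} accepted
...   | blockOne , restAccepted = SubtreeShape-leafInBlock⁺ ls (exactlyOneᵇ-sound (take c ls) blockOne)
                                    (finished-sound cs ss (drop c ls) (Fits-rest ls fit) restAccepted)

subtree-complete : ∀ cs ss ls → Fits cs ss ls → SubtreeShape cs ss ls → run cs notStarted ss ls ≡ true
subtree-complete []       []           [] _              (singleLeaf _ (_ , () , _))
subtree-complete (c ∷ cs) []           ls fits⟨ () , _ ⟩ _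
subtree-complete (c ∷ cs) (true ∷ ss)  ls fit shape =
  growing-complete cs ss (drop c ls) (Fits-rest ls fit) (SubtreeShape-start⁻ ls shape)
subtree-complete (c ∷ cs) (false ∷ ss) ls fit shape with noneᵇ (take c ls) in none
... | true  = subtree-complete cs ss (drop c ls) (Fits-rest ls fit)
                (SubtreeShape-skip⁻ ls (noneᵇ-sound (take c ls) none) shape)
... | false with SubtreeShape-leafInBlock⁻ ls none shape
...   | blockOne , nothingAfter rewrite exactlyOneᵇ-complete (take c ls) blockOne =
  finished-complete cs ss (drop c ls) (Fits-rest ls fit) nothingAfter

-- Subtrees of the caterpillar graph

∈-leafEdges⁻ : ∀ j nxt cs {u v} → (u , v) ∈ leafEdges j nxt cs →
  ∃ λ p → p < sum cs × u ≡ j + owner cs p × v ≡ nxt + p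
∈-leafEdges⁻ j nxt (c ∷ cs) e∈ with ∈-++⁻ (map (λ l → (j , nxt + l)) (upTo c)) e∈
... | inj₁ e∈block with ∈-map⁻ _ e∈block
...   | l , l∈ , refl = l , ≤-trans (∈-upTo⁻ l∈) (m≤m+n c (sum cs)) ,
                        sym (trans (cong (j +_) (owner-< c cs l (∈-upTo⁻ l∈))) (+-identityʳ j)) , refl
∈-leafEdges⁻ j nxt (c ∷ cs) e∈ | inj₂ e∈rest with ∈-leafEdges⁻ (suc j) (nxt + c) cs e∈rest
... | p , p< , refl , refl = c + p , +-monoʳ-< c p< ,
      trans (sym (+-suc j (owner cs p))) (cong (j +_) (sym (owner-+ c cs p))) , +-assoc nxt c p

∈-leafEdges⁺ : ∀ j nxt cs p → p < sum cs → (j + owner cs p , nxt + p) ∈ leafEdges j nxt cs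
∈-leafEdges⁺ j nxt (c ∷ cs) p p< with <⊎+ c p
... | inj₁ p<c rewrite owner-< c cs p p<c | +-identityʳ j = ∈-++⁺ˡ (∈-map⁺ (λ l → (j , nxt + l)) (∈-upTo⁺ p<c))
... | inj₂ (p′ , refl) rewrite owner-+ c cs p′ | +-suc j (owner cs p′) | sym (+-assoc nxt c p′) =
  ∈-++⁺ʳ (map (λ l → (j , nxt + l)) (upTo c)) (∈-leafEdges⁺ (suc j) (nxt + c) cs p′ (+-cancelˡ-< c _ _ p<))

owner<length : ∀ cs p → p < sum cs → owner cs p < length cs
owner<length (c ∷ cs) p p< with <⊎+ c p
... | inj₁ p<c rewrite owner-< c cs p p<c = s≤s z≤n
... | inj₂ (p′ , refl) rewrite owner-+ c cs p′ = s≤s (owner<length cs p′ (+-cancelˡ-< c _ _ p<))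

owner-++ : ∀ cs ds p → p < sum cs → owner (cs ++ ds) p ≡ owner cs p
owner-++ (c ∷ cs) ds p p< with <⊎+ c p
... | inj₁ p<c rewrite owner-< c (cs ++ ds) p p<c | owner-< c cs p p<c = refl
... | inj₂ (p′ , refl) rewrite owner-+ c (cs ++ ds) p′ | owner-+ c cs p′ =
  cong suc (owner-++ cs ds p′ (+-cancelˡ-< c _ _ p<))

Walk-source∈ : ∀ {E N} {S : Vec Bool N} {u v} → Walk E S u v → u ∈ₛ S
Walk-source∈ (here u∈)     = u∈
Walk-source∈ (step u∈ _ _) = u∈

_▸_ : ∀ {E N} {S : Vec Bool N} {u v w} → Walk E S u v → Walk E S v w → Walk E S u w
here _        ▸ q = q
step u∈ e∈ p ▸ q = step u∈ e∈ (p ▸ q)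

firstTrue : ∀ bs i → atB bs i ≡ true → ∃ λ a → atB bs a ≡ true × (∀ j → atB bs j ≡ true → a ≤ j)
firstTrue (true ∷ bs)  i       _      = 0 , refl , λ _ _ → z≤n
firstTrue (false ∷ bs) (suc i) chosen with firstTrue bs i chosen
... | a , chosenᵃ , least = suc a , chosenᵃ , λ where
  zero    ()
  (suc j) chosenʲ → s≤s (least j chosenʲ)

lastTrue : ∀ bs i → atB bs i ≡ true → ∃ λ b → atB bs b ≡ true × (∀ j → atB bs j ≡ true → j ≤ b)
lastTrue (x ∷ bs) i chosen with noneᵇ bs in none
lastTrue (x ∷ bs) zero    chosen | true = 0 , chosen , λ where
  zero    _       → z≤n
  (suc j) chosenʲ → contradiction (trans (sym chosenʲ) (noneᵇ-sound bs none j)) λ ()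
lastTrue (x ∷ bs) (suc i) chosen | true = contradiction (trans (sym chosen) (noneᵇ-sound bs none i)) λ ()
... | false with noneᵇ≡false⇒∃true bs none
...   | j , chosenʲ with lastTrue bs j chosenʲ
...     | b , chosenᵇ , greatest = suc b , chosenᵇ , λ where
  zero    _       → z≤n
  (suc j) chosenʲ → s≤s (greatest j chosenʲ)

module CaterpillarGraph (z : List ℕ) where

  k nSpine : ℕ
  k      = length z
  nSpine = length z + 2

  nSpine≡ : nSpine ≡ 2 + k
  nSpine≡ = +-comm k 2

  k<nSpine : k < nSpine
  k<nSpine = subst (k <_) (sym nSpine≡) (≤-trans (n<1+n k) (n≤1+n _))

  ≤k⇒suc<nSpine : ∀ {u} → u ≤ k → suc u < nSpine
  ≤k⇒suc<nSpine {u} u≤k = subst (suc u <_) (sym nSpine≡) (s≤s (s≤s u≤k))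

  owner-withEnds : ∀ p → p < sum z → owner (withEnds z) p ≡ suc (owner z p)
  owner-withEnds p p< = cong suc (owner-++ z [ 0 ] p p<)

  leafOwner≤k : ∀ p → p < sum z → owner (withEnds z) p ≤ k
  leafOwner≤k p p< rewrite owner-withEnds p p< = owner<length z p p<

  catEdge⁻ : ∀ {u w} → (u , w) ∈ catEdges z →
    (w ≡ suc u × u ≤ k) ⊎ (∃ λ p → p < sum z × u ≡ owner (withEnds z) p × w ≡ nSpine + p)
  catEdge⁻ e∈ with ∈-++⁻ (spineEdges k) e∈
  ... | inj₁ e∈spine with ∈-map⁻ _ e∈spine
  ...   | i , i∈ , refl = inj₁ (refl , s≤s⁻¹ (∈-upTo⁻ i∈))
  catEdge⁻ e∈ | inj₂ e∈leaves with ∈-leafEdges⁻ 1 nSpine z e∈leaves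
  ...   | p , p< , refl , refl = inj₂ (p , p< , sym (owner-withEnds p p<) , refl)

  spineEdge∈ : ∀ i → i ≤ k → (i , suc i) ∈ catEdges z
  spineEdge∈ i i≤k = ∈-++⁺ˡ (∈-map⁺ (λ i → (i , suc i)) (∈-upTo⁺ (s≤s i≤k)))

  leafEdge∈ : ∀ p → p < sum z → (owner (withEnds z) p , nSpine + p) ∈ catEdges z
  leafEdge∈ p p< rewrite owner-withEnds p p< = ∈-++⁺ʳ (spineEdges k) (∈-leafEdges⁺ 1 nSpine z p p<)

  catEdge-source≤k : ∀ {u w} → (u , w) ∈ catEdges z → u ≤ k
  catEdge-source≤k e∈ with catEdge⁻ e∈
  ... | inj₁ (_ , u≤k) = u≤k
  ... | inj₂ (p , p< , refl , _) = leafOwner≤k p p<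

  module _ (S : Vec Bool (catN z)) where

    private
      E : List Edge
      E = catEdges z
      bits : List Bool
      bits = toList S

    spineBits leafBits : List Bool
    spineBits = take nSpine bits
    leafBits  = drop nSpine bits

    length-spineBits : length spineBits ≡ nSpine
    length-spineBits = trans (length-take nSpine bits)
      (trans (cong (nSpine ⊓_) (length-toList S)) (m≤n⇒m⊓n≡m (m≤m+n nSpine (sum z))))

    length-leafBits : length leafBits ≡ sum z
    length-leafBits = trans (length-drop nSpine bits)
      (trans (cong (_∸ nSpine) (length-toList S)) (m+n∸m≡n nSpine (sum z)))

    fit : Fits (withEnds z) spineBits leafBits
    fit = fits⟨ trans length-spineBits (sym (length-withEnds z)) , trans length-leafBits (sym (sum-withEnds z)) ⟩

    spine∈ₛ : ∀ i → i < nSpine → atB bits i ≡ atB spineBits i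
    spine∈ₛ i i< = sym (atB-take nSpine bits i i<)

    leaf∈ₛ : ∀ p → atB bits (nSpine + p) ≡ atB leafBits p
    leaf∈ₛ p = sym (atB-drop nSpine bits p)

    shape⇒subtree : SubtreeShape (withEnds z) spineBits leafBits → IsSubtree (catN z) E S
    shape⇒subtree (singleLeaf spineFalse (p , chosen , unique)) = (nSpine + p , leaf∈) , connected
      where
      leaf∈ : (nSpine + p) ∈ₛ S
      leaf∈ = trans (leaf∈ₛ p) chosen
      onlyLeaf : ∀ v → v ∈ₛ S → v ≡ nSpine + p
      onlyLeaf v v∈ with <⊎+ nSpine v
      ... | inj₁ v< = contradiction (trans (sym v∈) (trans (spine∈ₛ v v<) (spineFalse v))) λ ()
      ... | inj₂ (p′ , refl) = cong (nSpine +_) (unique p′ (trans (sym (leaf∈ₛ p′)) v∈))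
      connected : ∀ u v → u ∈ₛ S → v ∈ₛ S → Walk E S u v
      connected u v u∈ v∈ = subst₂ (Walk E S) (sym (onlyLeaf u u∈)) (sym (onlyLeaf v v∈)) (here leaf∈)
    shape⇒subtree (spineSegment a b a≤b b< (spine⊆ , spine⊇) leaves) = (a , segment∈ a ≤-refl a≤b) , connected
      where
      b<nSpine : b < nSpine
      b<nSpine = subst (b <_) (length-withEnds z) b<
      edge≤k : ∀ j → suc j ≤ b → j ≤ k
      edge≤k j j<b = s≤s⁻¹ (≤-trans j<b (s≤s⁻¹ (subst (suc b ≤_) nSpine≡ b<nSpine)))
      segment∈ : ∀ i → a ≤ i → i ≤ b → i ∈ₛ S
      segment∈ i a≤i i≤b = trans (spine∈ₛ i (≤-<-trans i≤b b<nSpine)) (spine⊇ i a≤i i≤b)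
      walkUp : ∀ i j → a ≤ i → i ≤ j → j ≤ b → Walk E S i j
      walkUp i j a≤i i≤j j≤b with m≤n⇒m<n∨m≡n i≤j
      ... | inj₂ refl = here (segment∈ i a≤i j≤b)
      walkUp i (suc j) a≤i _ j<b | inj₁ (s≤s i≤j) =
        walkUp i j a≤i i≤j (<⇒≤ j<b)
        ▸ step (segment∈ j (≤-trans a≤i i≤j) (<⇒≤ j<b)) (inj₁ (spineEdge∈ j (edge≤k j j<b)))
               (here (segment∈ (suc j) (≤-trans a≤i (m≤n⇒m≤1+n i≤j)) j<b))
      walkDown : ∀ i j → a ≤ j → j ≤ i → i ≤ b → Walk E S i j
      walkDown i j a≤j j≤i i≤b with m≤n⇒m<n∨m≡n j≤i
      ... | inj₂ refl = here (segment∈ j a≤j i≤b)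
      walkDown (suc i) j a≤j _ i<b | inj₁ (s≤s j≤i) =
        step (segment∈ (suc i) (≤-trans a≤j (m≤n⇒m≤1+n j≤i)) i<b) (inj₂ (spineEdge∈ i (edge≤k i i<b)))
             (walkDown i j a≤j j≤i (<⇒≤ i<b))
      walkSpine : ∀ i j → a ≤ i → i ≤ b → a ≤ j → j ≤ b → Walk E S i j
      walkSpine i j a≤i i≤b a≤j j≤b with ≤-total i j
      ... | inj₁ i≤j = walkUp i j a≤i i≤j j≤b
      ... | inj₂ j≤i = walkDown i j a≤j j≤i i≤b
      toSegment : ∀ u → u ∈ₛ S → ∃ λ r → a ≤ r × r ≤ b × Walk E S u r × Walk E S r u
      toSegment u u∈ with <⊎+ nSpine u
      ... | inj₁ u< = let a≤u , u≤b = spine⊆ u (trans (sym (spine∈ₛ u u<)) u∈) in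
        u , a≤u , u≤b , here u∈ , here u∈
      ... | inj₂ (p , refl) = owner (withEnds z) p , a≤r , r≤b ,
          step u∈ (inj₂ (leafEdge∈ p p<)) (here r∈) , step r∈ (inj₁ (leafEdge∈ p p<)) (here u∈)
        where
        chosen : atB leafBits p ≡ true
        chosen = trans (sym (leaf∈ₛ p)) u∈
        p< : p < sum z
        p< = subst (p <_) length-leafBits (atB-true⇒< leafBits p chosen)
        a≤r : a ≤ owner (withEnds z) p
        a≤r = proj₁ (leaves p chosen)
        r≤b : owner (withEnds z) p ≤ b
        r≤b = proj₂ (leaves p chosen)
        r∈ : owner (withEnds z) p ∈ₛ S
        r∈ = segment∈ (owner (withEnds z) p) a≤r r≤b
      connected : ∀ u v → u ∈ₛ S → v ∈ₛ S → Walk E S u v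
      connected u v u∈ v∈ with toSegment u u∈ | toSegment v v∈
      ... | r , a≤r , r≤b , u⇝r , _ | r′ , a≤r′ , r′≤b , _ , r′⇝v =
        u⇝r ▸ (walkSpine r r′ a≤r r≤b a≤r′ r′≤b ▸ r′⇝v)

    position : ℕ → ℕ
    position u with nSpine ≤? u
    ... | yes _ = owner (withEnds z) (u ∸ nSpine)
    ... | no  _ = u

    position-spine : ∀ u → u < nSpine → position u ≡ u
    position-spine u u< with nSpine ≤? u
    ... | yes ≤u = contradiction ≤u (<⇒≱ u<)
    ... | no  _  = refl

    position-leaf : ∀ p → position (nSpine + p) ≡ owner (withEnds z) p
    position-leaf p with nSpine ≤? nSpine + p
    ... | yes _ = cong (owner (withEnds z)) (m+n∸m≡n nSpine p)
    ... | no ≰ = contradiction (m≤m+n nSpine p) ≰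

    leafOwner<nSpine : ∀ p → p < sum z → owner (withEnds z) p < nSpine
    leafOwner<nSpine p p< = ≤-<-trans (leafOwner≤k p p<) k<nSpine

    -- A leaf sits at the position of its spine neighbour, so each edge changes the position by
    -- at most one and a walk cannot jump over a spine vertex.
    walk-crosses : ∀ i {u v} → Walk E S u v → position u < i → i < position v → i ∈ₛ S
    walk-crosses i (here _) u<i i<v = contradiction u<i (<-asym i<v)
    walk-crosses i (step {u} u∈ (inj₁ e∈) rest) u<i i<v with catEdge⁻ e∈
    ... | inj₁ (refl , u≤k) with m≤n⇒m<n∨m≡n (subst (_< i) (position-spine u (≤-<-trans u≤k k<nSpine)) u<i)
    ...   | inj₂ refl = Walk-source∈ rest
    ...   | inj₁ 1+u<i =
      walk-crosses i rest (subst (_< i) (sym (position-spine (suc u) (≤k⇒suc<nSpine u≤k))) 1+u<i) i<v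
    walk-crosses i (step u∈ (inj₁ e∈) rest) u<i i<v | inj₂ (p , p< , refl , refl) =
      walk-crosses i rest
        (subst (_< i) (trans (position-spine _ (leafOwner<nSpine p p<)) (sym (position-leaf p))) u<i) i<v
    walk-crosses i (step {w = w} u∈ (inj₂ e∈) rest) u<i i<v with catEdge⁻ e∈
    ... | inj₁ (refl , w≤k) = walk-crosses i rest
      (subst (_< i) (sym (position-spine w (≤-<-trans w≤k k<nSpine)))
        (<-trans (n<1+n w) (subst (_< i) (position-spine (suc w) (≤k⇒suc<nSpine w≤k)) u<i))) i<v
    ... | inj₂ (p , p< , refl , refl) = walk-crosses i rest
      (subst (_< i) (trans (position-leaf p) (sym (position-spine _ (leafOwner<nSpine p p<)))) u<i) i<v

    leaf≰k : ∀ p → ¬ nSpine + p ≤ k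
    leaf≰k p = <⇒≱ (<-≤-trans k<nSpine (m≤m+n nSpine p))

    walk-from-leaf-passes-owner : ∀ p {v} → Walk E S (nSpine + p) v → v < nSpine → owner (withEnds z) p ∈ₛ S
    walk-from-leaf-passes-owner p (here _) v< = contradiction (m≤m+n nSpine p) (<⇒≱ v<)
    walk-from-leaf-passes-owner p (step _ (inj₁ e∈) _) _ = contradiction (catEdge-source≤k e∈) (leaf≰k p)
    walk-from-leaf-passes-owner p (step {w = w} _ (inj₂ e∈) rest) _ with catEdge⁻ e∈
    ... | inj₁ (eq , w≤k) = contradiction (subst (nSpine ≤_) eq (m≤m+n nSpine p)) (<⇒≱ (≤k⇒suc<nSpine w≤k))
    ... | inj₂ (p′ , _ , refl , eq) rewrite +-cancelˡ-≡ nSpine p p′ eq = Walk-source∈ rest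

    walk-from-leaf-without-spine : ∀ p {v} → AllFalse spineBits → Walk E S (nSpine + p) v → v ≡ nSpine + p
    walk-from-leaf-without-spine p _ (here _) = refl
    walk-from-leaf-without-spine p _ (step _ (inj₁ e∈) _) = contradiction (catEdge-source≤k e∈) (leaf≰k p)
    walk-from-leaf-without-spine p spineFalse (step {w = w} _ (inj₂ e∈) rest) = contradiction
      (trans (sym (Walk-source∈ rest)) (trans (spine∈ₛ w (≤-<-trans (catEdge-source≤k e∈) k<nSpine)) (spineFalse w)))
      λ ()

    subtree⇒shape : IsSubtree (catN z) E S → SubtreeShape (withEnds z) spineBits leafBits
    subtree⇒shape ((u₀ , u₀∈) , connected) with noneᵇ spineBits in none
    ... | true = singleLeaf spineFalse (p₀ , chosen₀ , unique)
      where
      spineFalse : AllFalse spineBits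
      spineFalse = noneᵇ-sound spineBits none
      leaf₀ : ∃ λ p → u₀ ≡ nSpine + p
      leaf₀ with <⊎+ nSpine u₀
      ... | inj₁ u₀< = contradiction (trans (sym u₀∈) (trans (spine∈ₛ u₀ u₀<) (spineFalse u₀))) λ ()
      ... | inj₂ p = p
      p₀ : ℕ
      p₀ = proj₁ leaf₀
      chosen₀ : atB leafBits p₀ ≡ true
      chosen₀ = trans (sym (leaf∈ₛ p₀)) (subst (_∈ₛ S) (proj₂ leaf₀) u₀∈)
      unique : ∀ q → atB leafBits q ≡ true → q ≡ p₀
      unique q chosen = +-cancelˡ-≡ nSpine q p₀ (walk-from-leaf-without-spine p₀ spineFalse
        (connected (nSpine + p₀) (nSpine + q) (trans (leaf∈ₛ p₀) chosen₀) (trans (leaf∈ₛ q) chosen)))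
    ... | false with noneᵇ≡false⇒∃true spineBits none
    ...   | i , chosenⁱ with firstTrue spineBits i chosenⁱ | lastTrue spineBits i chosenⁱ
    ...     | a , chosenᵃ , least | b , chosenᵇ , greatest =
      spineSegment a b (least b chosenᵇ) (subst (b <_) (sym (length-withEnds z)) b<nSpine) (spine⊆ , spine⊇) leaves
      where
      a<nSpine : a < nSpine
      a<nSpine = subst (a <_) length-spineBits (atB-true⇒< spineBits a chosenᵃ)
      b<nSpine : b < nSpine
      b<nSpine = subst (b <_) length-spineBits (atB-true⇒< spineBits b chosenᵇ)
      a∈ : a ∈ₛ S
      a∈ = trans (spine∈ₛ a a<nSpine) chosenᵃ
      b∈ : b ∈ₛ S
      b∈ = trans (spine∈ₛ b b<nSpine) chosenᵇ
      spine⊆ : ∀ i → atB spineBits i ≡ true → a ≤ i × i ≤ b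
      spine⊆ i chosen = least i chosen , greatest i chosen
      spine⊇ : ∀ i → a ≤ i → i ≤ b → atB spineBits i ≡ true
      spine⊇ i a≤i i≤b with m≤n⇒m<n∨m≡n a≤i | m≤n⇒m<n∨m≡n i≤b
      ... | inj₂ refl | _         = chosenᵃ
      ... | inj₁ _    | inj₂ refl = chosenᵇ
      ... | inj₁ a<i  | inj₁ i<b  = trans (sym (spine∈ₛ i (<-trans i<b b<nSpine)))
        (walk-crosses i (connected a b a∈ b∈)
          (subst (_< i) (sym (position-spine a a<nSpine)) a<i) (subst (i <_) (sym (position-spine b b<nSpine)) i<b))
      leaves : LeavesWithin a b (withEnds z) leafBits
      leaves p chosen = spine⊆ (owner (withEnds z) p) (trans (sym (spine∈ₛ _ (leafOwner<nSpine p p<))) owner∈)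
        where
        p< : p < sum z
        p< = subst (p <_) length-leafBits (atB-true⇒< leafBits p chosen)
        owner∈ : owner (withEnds z) p ∈ₛ S
        owner∈ = walk-from-leaf-passes-owner p (connected (nSpine + p) a (trans (leaf∈ₛ p) chosen) a∈) a<nSpine

φ-counts-subtrees : ∀ z → φCat≡ z (φ z)
φ-counts-subtrees z with enumerate (catN z) (isSubtreeᵇ z)
... | L , unique , mem , len = L , unique , mem′ , trans len (∑Bits-isSubtreeᵇ z)
  where
  open CaterpillarGraph z
  mem′ : ∀ S → S ∈ L ⇔ IsSubtree (catN z) (catEdges z) S
  mem′ S = mk⇔ (shape⇒subtree S ∘ subtree-sound _ _ _ (fit S) ∘ Equivalence.to (mem S))
               (Equivalence.from (mem S) ∘ subtree-complete _ _ _ (fit S) ∘ subtree⇒shape S)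

swapAt-↭ : ∀ z j → 1 ≤ j → suc j ≤ length z → swapAt z j ↭ z
swapAt-↭ z j 1≤j j<n = subst (swapAt z j ↭_) (sym (splitAt z j 1≤j j<n))
  (↭-++⁺ˡ (take (j ∸ 1) z) (↭-swap (at z (suc j)) (at z j) ↭-refl))

length-excess : ∀ d k → k ≤ length d → length (excess d k) ≡ k
length-excess d k k≤ = trans (length-map _ (take k d)) (trans (length-take k d) (m≤n⇒m⊓n≡m k≤))

2^-< : ∀ {a b} → a < b → 2 ^ a < 2 ^ b
2^-< = ^-monoʳ-< 2 (s≤s (s≤s z≤n))

maximal⇒¬swap-gain : ∀ {zs} z → z ↭ zs →
  (∀ z′ → z′ ↭ zs → ∀ m m′ → φCat≡ z m → φCat≡ z′ m′ → m′ ≤ m) →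
  ∀ j → 1 ≤ j → suc j ≤ length z →
  let A = 2 ^ at z j ; B = 2 ^ at z (suc j) ; L = leftWeight z j ; R = rightWeight z j in
  ¬ A * L + B * R < A * R + B * L
maximal⇒¬swap-gain z z↭ maximal j 1≤j j<n gain = <⇒≱ (φ-swapAt-< z j 1≤j j<n gain)
  (maximal (swapAt z j) (↭-trans (swapAt-↭ z j 1≤j j<n) z↭) (φ z) (φ (swapAt z j))
    (φ-counts-subtrees z) (φ-counts-subtrees (swapAt z j)))

theorem3p5 : (d : List ℕ) (k : ℕ) → IsTreeDegSeq d → ShapeOK d k →
    (z : List ℕ) → z ↭ excess d k →
    (∀ z' → z' ↭ excess d k → ∀ m m' → φCat≡ z m → φCat≡ z' m' → m' ≤ m) →
    ∃ λ t → (1 ≤ t) × (t ≤ k ∸ 1)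
      × (∀ i → 1 ≤ i → suc i ≤ t ∸ 1 → at z i ≤ at z (suc i))
      × (2 ≤ t → at z (t ∸ 1) < at z t)
      × (∀ i → t ≤ i → suc i ≤ k → at z (suc i) ≤ at z i)
theorem3p5 d (suc M) _ (3≤k , k≤n , _) z z↭ optimal =
  weightCrossing⇒strictPeak {at z} {leftWeight z} {rightWeight z}
    (λ j 1≤j j<M → leftWeight-increasing z j 1≤j (in-range (m≤n⇒m≤1+n j<M)))
    (λ j _ j<M → rightWeight-decreasing z j (in-range (s≤s j<M)))
    (rightWeight<leftWeight-at-end z M length-z (s≤s⁻¹ 3≤k))
    (λ j 1≤j j≤M R<L → ≮⇒≥ λ a<b → maximal⇒¬swap-gain z z↭ optimal j 1≤j (in-range (s≤s j≤M))
      (rearrangement (2^-< a<b) R<L))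
    (λ j 1≤j j≤M L<R → ≮⇒≥ λ b<a → maximal⇒¬swap-gain z z↭ optimal j 1≤j (in-range (s≤s j≤M))
      (subst₂ _<_ (+-comm _ (2 ^ at z j * leftWeight z j)) (+-comm _ (2 ^ at z j * rightWeight z j))
        (rearrangement (2^-< b<a) L<R)))
    (≤-trans (s≤s z≤n) (s≤s⁻¹ 3≤k))
  where
  length-z : length z ≡ suc M
  length-z = trans (↭-length z↭) (length-excess d (suc M) k≤n)
  in-range : ∀ {i} → i ≤ suc M → i ≤ length z
  in-range = subst (_ ≤_) (sym length-z)
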